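{- Let $G$ be a graph such that both $G$ and $\overline{G}$ are induced-minor-minimal non-$2$-cographs. If $G$ has a path $P$ of length greater than three all of whose internal vertices have degree two in $G$, then $G$ is isomorphic to the $5$-cycle $C_5$.
   Context: All graphs are finite and simple; $\overline{G}$ denotes the complement of $G$. The length of a path is its number of edges. A graph is $2$-connected if it has at least three vertices, is connected, and has no cut vertex. A graph $G$ is a $2$-cograph if $G$ has no induced subgraph $H$ such that both $H$ and $\overline{H}$ are $2$-connected. For an edge $e$, $G/e$ is the simple graph obtained by contracting $e$ and removing parallel edges. An induced minor of $G$ is a graph obtained from $G$ by a sequence of vertex deletions and edge contractions; it is proper if at least one such operation is performed. An induced-minor-minimal non-$2$-cograph is a graph that is not a $2$-cograph but all of whose proper induced minors are $2$-cographs. -}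

module Defs where

open import Level using (0ℓ)
open import Data.Nat using (ℕ; zero; suc; _<_; _+_; _%_; _≡ᵇ_)
open import Data.Fin using (Fin; toℕ; inject₁) renaming (suc to fsuc; zero to fzero)
open import Data.Bool using (Bool; true; false; T; not; _∨_; if_then_else_)
open import Data.Bool.Properties using (∨-comm)
open import Data.Product using (Σ; _×_; _,_; proj₁; proj₂; ∃)
open import Data.Sum using (_⊎_; inj₁; inj₂)
open import Data.Empty using (⊥)
open import Data.Unit using (tt)
open import Relation.Nullary using (¬_; Dec; yes; no; does)
open import Relation.Binary.Definitions using (DecidableEquality)
open import Relation.Binary.PropositionalEquality using (_≡_; _≢_; refl; cong; subst)
open import Function using (_∘_)
open import Function.Bundles using (_↔_; _⇔_)

record Graph : Set₁ where
  field
    V     : Set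
    _≟V_  : DecidableEquality V
    E     : V → V → Set
    E-sym : ∀ {x y} → E x y → E y x
    E-irr : ∀ {x} → ¬ E x x

open Graph public

Finite : Graph → Set
Finite G = Σ ℕ λ n → V G ↔ Fin n

-- Decidable adjacency (automatic for finite graphs classically).
DecAdj : Graph → Set
DecAdj G = ∀ x y → Dec (E G x y)

T-irr : ∀ b (p q : T b) → p ≡ q
T-irr true _ _ = refl

subDec : {A : Set} → DecidableEquality A → (P : A → Bool) →
         DecidableEquality (Σ A λ x → T (P x))
subDec d P (x , p) (y , q) with d x y
... | yes refl = yes (cong (x ,_) (T-irr (P x) p q))
... | no ne = no (ne ∘ cong proj₁)

Induced : (G : Graph) → (V G → Bool) → Graph
Induced G S = record
  { V = Σ (V G) λ x → T (S x)
  ; _≟V_ = subDec (_≟V_ G) S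
  ; E = λ x y → E G (proj₁ x) (proj₁ y)
  ; E-sym = E-sym G
  ; E-irr = E-irr G
  }

NotV : (G : Graph) → V G → V G → Bool
NotV G w x = not (does (_≟V_ G x w))

Delete : (G : Graph) → V G → Graph
Delete G w = Induced G (NotV G w)

Complement : Graph → Graph
Complement G = record
  { V = V G
  ; _≟V_ = _≟V_ G
  ; E = λ x y → (x ≢ y) × ¬ E G x y
  ; E-sym = λ { (ne , nE) → (λ eq → ne (symm eq)) , (λ e → nE (E-sym G e)) }
  ; E-irr = λ { (ne , _) → ne refl }
  }
  where
    symm : ∀ {x y : V G} → x ≡ y → y ≡ x
    symm refl = refl

-- G / uv : contract the edge uv (v is merged into u; parallel edges and
-- loops are discarded).
Contract : (G : Graph) → V G → V G → Graph
Contract G u v = record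
  { V = Σ (V G) λ x → T (NotV G v x)
  ; _≟V_ = subDec (_≟V_ G) (NotV G v)
  ; E = λ x y → (proj₁ x ≢ proj₁ y) ×
          (Σ (V G) λ a → Σ (V G) λ b → E G a b × (rep a ≡ proj₁ x) × (rep b ≡ proj₁ y))
  ; E-sym = λ { (ne , a , b , e , p , q) → (λ eq → ne (symm eq)) , b , a , E-sym G e , q , p }
  ; E-irr = λ { (ne , _) → ne refl }
  }
  where
    rep : V G → V G
    rep a = if does (_≟V_ G a v) then u else a
    symm : ∀ {x y : V G} → x ≡ y → y ≡ x
    symm refl = refl

data Reach (G : Graph) : V G → V G → Set where
  stop : ∀ {x} → Reach G x x
  step : ∀ {x y z} → E G x y → Reach G y z → Reach G x z

Connected : Graph → Set
Connected G = ∀ x y → Reach G x y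

TwoConnected : Graph → Set
TwoConnected G =
  (Σ (V G) λ x → Σ (V G) λ y → Σ (V G) λ z → x ≢ y × x ≢ z × y ≢ z)
  × Connected G
  × ¬ (Σ (V G) λ w → ¬ Connected (Delete G w))

TwoCograph : Graph → Set
TwoCograph G = ¬ (Σ (V G → Bool) λ S →
  TwoConnected (Induced G S) × TwoConnected (Complement (Induced G S)))

data IndMinor : Graph → Graph → Set₁ where
  here : ∀ {G} → IndMinor G G
  del  : ∀ {G H} (w : V G) → IndMinor (Delete G w) H → IndMinor G H
  con  : ∀ {G H} (u v : V G) → E G u v → IndMinor (Contract G u v) H → IndMinor G H

ProperIndMinor : Graph → Graph → Set₁
ProperIndMinor G H =
  (Σ (V G) λ w → IndMinor (Delete G w) H)
  ⊎ (Σ (V G) λ u → Σ (V G) λ v → E G u v × IndMinor (Contract G u v) H)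

MinimalNon2Cograph : Graph → Set₁
MinimalNon2Cograph G =
  ¬ TwoCograph G × (∀ H → ProperIndMinor G H → TwoCograph H)

Degree2 : (G : Graph) → V G → Set
Degree2 G x = Σ (V G) λ a → Σ (V G) λ b →
  a ≢ b × E G x a × E G x b × (∀ c → E G x c → c ≡ a ⊎ c ≡ b)

record Path (G : Graph) : Set where
  field
    len  : ℕ
    vtx  : Fin (suc len) → V G
    inj  : ∀ i j → vtx i ≡ vtx j → i ≡ j
    adj  : ∀ (i : Fin len) → E G (vtx (inject₁ i)) (vtx (fsuc i))

open Path public

InternalDegree2 : (G : Graph) → Path G → Set
InternalDegree2 G P = ∀ (i : Fin (len P)) → 0 < toℕ i → Degree2 G (vtx P (inject₁ i))

adj5 : Fin 5 → Fin 5 → Bool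
adj5 i j = ((toℕ i + 1) % 5 ≡ᵇ toℕ j) ∨ ((toℕ j + 1) % 5 ≡ᵇ toℕ i)

C5 : Graph
C5 = record
  { V = Fin 5
  ; _≟V_ = Data.Fin._≟_
  ; E = λ i j → T (adj5 i j)
  ; E-sym = λ {i} {j} e → subst T (∨-comm ((toℕ i + 1) % 5 ≡ᵇ toℕ j) ((toℕ j + 1) % 5 ≡ᵇ toℕ i)) e
  ; E-irr = λ {x} → irr {x}
  }
  where
    irr : ∀ {x} → ¬ T (adj5 x x)
    irr {fzero} ()
    irr {fsuc fzero} ()
    irr {fsuc (fsuc fzero)} ()
    irr {fsuc (fsuc (fsuc fzero))} ()
    irr {fsuc (fsuc (fsuc (fsuc fzero)))} ()

_≅_ : Graph → Graph → Set
G ≅ H = Σ (V G ↔ V H) λ f →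
  ∀ x y → E G x y ⇔ E H (Function.Bundles.Inverse.to f x) (Function.Bundles.Inverse.to f y)

-- Cycles of length at least five and their complements are 2-connected, so no proper induced
-- minor of G contains such a cycle as an induced subgraph.  Let p₀ … p₄ be the first five
-- vertices of P, so p₁, p₂, p₃ have degree two.  If p₀p₄ is an edge, p₀ … p₄ is an induced
-- C₅, and it contains every vertex, since deleting any other one gives a proper induced minor.
-- Otherwise G has no cut vertex (minimality forces the induced subgraph witnessing that G is
-- not a 2-cograph to be all of G), so G − p₂ is connected.  Sending p₁ to p₀ and p₃ to p₄
-- turns a p₀–p₄ walk in G − p₂ into one avoiding p₁, p₂, p₃, which shortcuts to an induced
-- path of length at least two.  In G/p₂p₃ this path, p₁ and the merged vertex form an induced
-- cycle of length at least five, a contradiction.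

module Submission where

open import Defs
open import Data.Nat using (ℕ; zero; suc; _+_; _<_; s≤s; z≤n)
open import Data.Nat.Properties using (1+n≢n)
open import Data.Fin using (Fin; toℕ; fromℕ; inject₁; _≟_) renaming (zero to fzero; suc to fsuc)
open import Data.Fin.Properties using (toℕ-inject₁) renaming (any? to anyFin?; all? to allFin?)
open import Data.Fin.Induction using (<-weakInduction)
open import Data.Fin.Patterns using (0F; 1F; 2F; 3F; 4F)
open import Data.Bool using (Bool; true; false; T; if_then_else_)
open import Data.List using (List; []; _∷_; length; lookup; map)
open import Data.List.Relation.Unary.All as All using (All; []; _∷_)
open import Data.List.Relation.Unary.All.Properties using (map⁺)
open import Data.List.Relation.Unary.Any using (Any; here; there; any?)
open import Data.List.Membership.Propositional.Properties using (∈-lookup)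
open import Data.Product using (Σ; _×_; _,_; proj₁; proj₂)
open import Data.Sum using (_⊎_; inj₁; inj₂; [_,_]′) renaming (map to ⊎-map; map₂ to ⊎-map₂; swap to ⊎-swap)
open import Data.Empty using (⊥-elim)
open import Data.Unit using (⊤; tt)
open import Relation.Nullary using (¬_; Dec; yes; no; does)
open import Relation.Nullary.Decidable using (isYes; ¬?; toWitness; fromWitness; T?; _⊎-dec_; _×-dec_; _→-dec_)
open import Relation.Binary.PropositionalEquality using (_≡_; _≢_; refl; sym; trans; cong; subst; subst₂; ≢-sym)
open import Function using (_∘_; id)
open import Function.Bundles using (_⇔_; mk⇔; mk↔ₛ′)

E⇒≢ : ∀ G {x y} → E G x y → x ≢ y
E⇒≢ G xy refl = E-irr G xy

Reach-trans : ∀ {G x y z} → Reach G x y → Reach G y z → Reach G x z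
Reach-trans stop q = q
Reach-trans (step e p) q = step e (Reach-trans p q)

Reach-sym : ∀ {G x y} → Reach G x y → Reach G y x
Reach-sym stop = stop
Reach-sym {G} (step e p) = Reach-trans (Reach-sym p) (step (E-sym G e) stop)

EdgeCollapsing : (A B : Graph) → (V A → V B) → Set
EdgeCollapsing A B f = ∀ {x y} → E A x y → f x ≡ f y ⊎ E B (f x) (f y)

Reach-map : ∀ {A B} (f : V A → V B) → EdgeCollapsing A B f →
            ∀ {x y} → Reach A x y → Reach B (f x) (f y)
Reach-map f f-collapsing stop = stop
Reach-map {B = B} f f-collapsing (step {z = z} e p) with f-collapsing e
... | inj₁ fx≡fy = subst (λ u → Reach B u (f z)) (sym fx≡fy) (Reach-map f f-collapsing p)
... | inj₂ e′ = step e′ (Reach-map f f-collapsing p)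

Connected-via : ∀ {G} (h : V G) → (∀ x → Reach G x h) → Connected G
Connected-via h r x y = Reach-trans (r x) (Reach-sym (r y))

NotV-intro : ∀ G {w x} → x ≢ w → T (NotV G w x)
NotV-intro G {w} {x} x≢w with _≟V_ G x w
... | yes x≡w = x≢w x≡w
... | no _ = tt

NotV-elim : ∀ G {w x} → T (NotV G w x) → x ≢ w
NotV-elim G {w} {x} t with _≟V_ G x w
NotV-elim G {w} {x} () | yes _
... | no x≢w = x≢w

subtype-≡ : ∀ {A : Set} {P : A → Bool} {a b : Σ A (T ∘ P)} → proj₁ a ≡ proj₁ b → a ≡ b
subtype-≡ {P = P} {x , p} {.x , q} refl = cong (x ,_) (T-irr (P x) p q)

Connected-from-Delete : ∀ G (w u : V G) → E G w u → Connected (Delete G w) → Connected G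
Connected-from-Delete G w u wu conn = Connected-via u reach
  where
    reach : ∀ x → Reach G x u
    reach x with _≟V_ G x w
    ... | yes refl = step wu stop
    ... | no x≢w = Reach-map proj₁ inj₂
                     (conn (x , NotV-intro G x≢w) (u , NotV-intro G (≢-sym (E⇒≢ G wu))))

TwoConnected-intro : ∀ G → (Σ (V G) λ x → Σ (V G) λ y → Σ (V G) λ z → x ≢ y × x ≢ z × y ≢ z) →
                     ∀ {w u} → E G w u → (∀ v → Connected (Delete G v)) → TwoConnected G
TwoConnected-intro G three wu Delete-connected =
  three , Connected-from-Delete G _ _ wu (Delete-connected _) , λ (v , ¬conn) → ¬conn (Delete-connected v)

-- Graph isomorphisms

record Iso (A B : Graph) : Set where
  field
    to      : V A → V B
    from    : V B → V A
    to-from : ∀ y → to (from y) ≡ y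
    from-to : ∀ x → from (to x) ≡ x
    to-E    : ∀ {x y} → E A x y → E B (to x) (to y)
    from-E  : ∀ {x y} → E B x y → E A (from x) (from y)

  to-injective : ∀ {x y} → to x ≡ to y → x ≡ y
  to-injective {x} {y} eq = trans (sym (from-to x)) (trans (cong from eq) (from-to y))

  from-injective : ∀ {x y} → from x ≡ from y → x ≡ y
  from-injective {x} {y} eq = trans (sym (to-from x)) (trans (cong to eq) (to-from y))

open Iso

Iso-Connected : ∀ {A B} → Iso A B → Connected A → Connected B
Iso-Connected {B = B} I conn x y =
  subst₂ (Reach B) (to-from I x) (to-from I y)
    (Reach-map (to I) (inj₂ ∘ to-E I) (conn (from I x) (from I y)))

Iso-Delete : ∀ {A B} (I : Iso A B) (x : V A) → Iso (Delete A x) (Delete B (to I x))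
Iso-Delete {A} {B} I x = record
  { to      = λ { (v , v≢x) → to I v , NotV-intro B (NotV-elim A v≢x ∘ to-injective I) }
  ; from    = λ { (u , u≢x) → from I u , NotV-intro A λ eq →
                    NotV-elim B u≢x (trans (sym (to-from I u)) (cong (to I) eq)) }
  ; to-from = λ { (u , _) → subtype-≡ (to-from I u) }
  ; from-to = λ { (v , _) → subtype-≡ (from-to I v) }
  ; to-E    = to-E I
  ; from-E  = from-E I
  }

Iso-Complement : ∀ {A B} → Iso A B → Iso (Complement A) (Complement B)
Iso-Complement {A} {B} I = record
  { to = to I ; from = from I ; to-from = to-from I ; from-to = from-to I
  ; to-E   = λ { {x} {y} (x≢y , ¬xy) → x≢y ∘ to-injective I ,
                   ¬xy ∘ subst₂ (E A) (from-to I x) (from-to I y) ∘ from-E I }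
  ; from-E = λ { {x} {y} (x≢y , ¬xy) → x≢y ∘ from-injective I ,
                   ¬xy ∘ subst₂ (E B) (to-from I x) (to-from I y) ∘ to-E I }
  }

Iso-TwoConnected : ∀ {A B} → Iso A B → TwoConnected A → TwoConnected B
Iso-TwoConnected {A} {B} I ((x , y , z , x≢y , x≢z , y≢z) , conn , noCut) =
  (to I x , to I y , to I z , x≢y ∘ to-injective I , x≢z ∘ to-injective I , y≢z ∘ to-injective I) ,
  Iso-Connected I conn ,
  λ { (w , ¬conn) → noCut (from I w , λ connA → ¬conn
        (subst (Connected ∘ Delete B) (to-from I w) (Iso-Connected (Iso-Delete I (from I w)) connA))) }

-- Cycles

data LastOrInject {n : ℕ} : Fin (suc n) → Set where
  last   : LastOrInject (fromℕ n)
  inject : (k : Fin n) → LastOrInject (inject₁ k)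

lastOrInject : ∀ {n} (i : Fin (suc n)) → LastOrInject i
lastOrInject {zero} fzero = last
lastOrInject {suc n} fzero = inject fzero
lastOrInject {suc n} (fsuc i) with lastOrInject i
... | last = last
... | inject k = inject (fsuc k)

lastOrInject-fromℕ : ∀ n → lastOrInject (fromℕ n) ≡ last
lastOrInject-fromℕ zero = refl
lastOrInject-fromℕ (suc n) rewrite lastOrInject-fromℕ n = refl

lastOrInject-inject₁ : ∀ {n} (k : Fin n) → lastOrInject (inject₁ k) ≡ inject k
lastOrInject-inject₁ {suc n} fzero = refl
lastOrInject-inject₁ {suc n} (fsuc k) rewrite lastOrInject-inject₁ k = refl

next : ∀ {n} → Fin (suc n) → Fin (suc n)
next i with lastOrInject i
... | last = fzero
... | inject k = fsuc k

prev : ∀ {n} → Fin (suc n) → Fin (suc n)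
prev {n} fzero = fromℕ n
prev (fsuc k) = inject₁ k

next-fromℕ : ∀ n → next (fromℕ n) ≡ fzero
next-fromℕ n rewrite lastOrInject-fromℕ n = refl

next-inject₁ : ∀ {n} (k : Fin n) → next (inject₁ k) ≡ fsuc k
next-inject₁ k rewrite lastOrInject-inject₁ k = refl

prev-next : ∀ {n} (i : Fin (suc n)) → prev (next i) ≡ i
prev-next i with lastOrInject i
... | last = refl
... | inject k = refl

next-prev : ∀ {n} (i : Fin (suc n)) → next (prev i) ≡ i
next-prev {n} fzero = next-fromℕ n
next-prev (fsuc k) = next-inject₁ k

next-injective : ∀ {n} {i j : Fin (suc n)} → next i ≡ next j → i ≡ j
next-injective {i = i} {j} eq = trans (sym (prev-next i)) (trans (cong prev eq) (prev-next j))

next-irreflexive : ∀ {n} (i : Fin (suc (suc n))) → next i ≢ i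
next-irreflexive i with lastOrInject i
... | last = λ ()
... | inject k = λ eq → 1+n≢n (trans (cong toℕ eq) (toℕ-inject₁ k))

next-induction : ∀ {n} (P : Fin (suc n) → Set) → P fzero → (∀ i → P i → P (next i)) → ∀ i → P i
next-induction P P₀ P-next = <-weakInduction P P₀ λ i → subst P (next-inject₁ i) ∘ P-next (inject₁ i)

CycleAdj : ∀ {n} → Fin (suc n) → Fin (suc n) → Set
CycleAdj i j = next i ≡ j ⊎ next j ≡ i

LongCycle : ℕ → Graph
LongCycle k = record
  { V     = Fin (5 + k)
  ; _≟V_  = _≟_
  ; E     = CycleAdj
  ; E-sym = λ { (inj₁ a) → inj₂ a ; (inj₂ a) → inj₁ a }
  ; E-irr = λ { {i} (inj₁ a) → next-irreflexive i a ; {i} (inj₂ a) → next-irreflexive i a }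
  }

rotation : ∀ {k} → Iso (LongCycle k) (LongCycle k)
rotation = record
  { to = next ; from = prev ; to-from = next-prev ; from-to = prev-next
  ; to-E   = λ { (inj₁ a) → inj₁ (cong next a) ; (inj₂ a) → inj₂ (cong next a) }
  ; from-E = λ { {i} (inj₁ a) → inj₁ (prev-step i a) ; {_} {j} (inj₂ a) → inj₂ (prev-step j a) }
  }
  where
    prev-step : ∀ {n} (i : Fin (suc n)) {j} → next i ≡ j → next (prev i) ≡ prev j
    prev-step i refl = trans (next-prev i) (sym (prev-next i))

module _ {k : ℕ} where

  private
    C = LongCycle k
    v₀ v₁ v₂ : Fin (5 + k)
    v₀ = fzero
    v₁ = fsuc fzero
    v₂ = fsuc (fsuc fzero)

  three-vertices : Σ (Fin (5 + k)) λ x → Σ (Fin (5 + k)) λ y → Σ (Fin (5 + k)) λ z →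
                   x ≢ y × x ≢ z × y ≢ z
  three-vertices = v₀ , v₁ , v₂ , (λ ()) , (λ ()) , (λ ())

  LongCycle-Delete₀-connected : Connected (Delete C v₀)
  LongCycle-Delete₀-connected = Connected-via (vertex v₁ (λ ())) λ { (fsuc i , _) → down i }
    where
      vertex : (i : Fin (5 + k)) → i ≢ v₀ → V (Delete C v₀)
      vertex i i≢v₀ = i , NotV-intro C i≢v₀
      down : ∀ i → Reach (Delete C v₀) (vertex (fsuc i) (λ ())) (vertex v₁ (λ ()))
      down = <-weakInduction _ stop
               λ i → step {y = vertex (fsuc (inject₁ i)) (λ ())} (inj₂ (next-inject₁ (fsuc i)))

  LongCycle-Delete-connected : ∀ w → Connected (Delete C w)
  LongCycle-Delete-connected =
    next-induction (Connected ∘ Delete C) LongCycle-Delete₀-connected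
      λ w → Iso-Connected (Iso-Delete rotation w)

  LongCycle-TwoConnected : TwoConnected C
  LongCycle-TwoConnected = TwoConnected-intro C three-vertices {v₀} {v₁} (inj₁ refl) LongCycle-Delete-connected

  private
    C̄ = Complement C

    C̄-edge : ∀ {x y : Fin (5 + k)} → x ≢ y → next x ≢ y → next y ≢ x → E C̄ x y
    C̄-edge x≢y x↛y y↛x = x≢y , λ { (inj₁ a) → x↛y a ; (inj₂ a) → y↛x a }

    vlast : Fin (5 + k)
    vlast = fromℕ (4 + k)

    next-vlast≢ : ∀ {x} → x ≢ v₀ → next vlast ≢ x
    next-vlast≢ x≢v₀ eq = x≢v₀ (trans (sym eq) (next-fromℕ (4 + k)))

  Complement-LongCycle-Delete₀-connected : Connected (Delete C̄ v₀)
  Complement-LongCycle-Delete₀-connected = Connected-via (vertex v₁ (λ ())) reach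
    where
      vertex : (i : Fin (5 + k)) → i ≢ v₀ → V (Delete C̄ v₀)
      vertex i i≢v₀ = i , NotV-intro C i≢v₀
      reach : ∀ x → Reach (Delete C̄ v₀) x (vertex v₁ (λ ()))
      reach (fzero , v₀≢v₀) = ⊥-elim (NotV-elim C {v₀} v₀≢v₀ refl)
      reach (fsuc fzero , _) = stop
      reach (fsuc (fsuc fzero) , _) =
        step {y = vertex vlast (λ ())} (C̄-edge (λ ()) (λ ()) (next-vlast≢ λ ()))
          (step (C̄-edge (λ ()) (next-vlast≢ λ ()) (λ ())) stop)
      reach (fsuc (fsuc (fsuc i)) , _) =
        step (C̄-edge (λ ()) (λ eq → ≢v₀ (next-injective eq)) (λ ())) stop
        where ≢v₀ : fsuc (fsuc (fsuc i)) ≢ v₀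
              ≢v₀ ()

  Complement-LongCycle-Delete-connected : ∀ w → Connected (Delete C̄ w)
  Complement-LongCycle-Delete-connected =
    next-induction (Connected ∘ Delete C̄) Complement-LongCycle-Delete₀-connected
      λ w → Iso-Connected (Iso-Delete (Iso-Complement rotation) w)

  Complement-LongCycle-TwoConnected : TwoConnected C̄
  Complement-LongCycle-TwoConnected =
    TwoConnected-intro C̄ three-vertices {v₀} {v₂} (C̄-edge (λ ()) (λ ()) (λ ()))
      Complement-LongCycle-Delete-connected

-- Obstructions and minimality

Obstruction : Graph → Set
Obstruction H = Σ (V H → Bool) λ S → TwoConnected (Induced H S) × TwoConnected (Complement (Induced H S))

Minimal : Graph → Set₁
Minimal G = ∀ H → ProperIndMinor G H → TwoCograph H

record InducedCycle (H : Graph) (k : ℕ) : Set where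
  field
    vertex           : Fin (5 + k) → V H
    vertex-injective : ∀ {i j} → vertex i ≡ vertex j → i ≡ j
    E⇒CycleAdj       : ∀ {i j} → E H (vertex i) (vertex j) → CycleAdj i j
    CycleAdj⇒E       : ∀ {i j} → CycleAdj i j → E H (vertex i) (vertex j)

  OnCycle : V H → Set
  OnCycle v = Σ (Fin (5 + k)) λ i → vertex i ≡ v

  onCycle? : ∀ v → Dec (OnCycle v)
  onCycle? v = anyFin? λ i → _≟V_ H (vertex i) v

  onCycle : V H → Bool
  onCycle = isYes ∘ onCycle?

  LongCycle-Iso : Iso (LongCycle k) (Induced H onCycle)
  LongCycle-Iso = record
    { to      = λ i → vertex i , fromWitness (i , refl)
    ; from    = λ { (v , v∈) → proj₁ (toWitness v∈) }
    ; to-from = λ { (v , v∈) → subtype-≡ (proj₂ (toWitness v∈)) }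
    ; from-to = λ i →
        vertex-injective (proj₂ (toWitness {a? = onCycle? (vertex i)} (fromWitness (i , refl))))
    ; to-E    = CycleAdj⇒E
    ; from-E  = λ { {v , v∈} {w , w∈} e →
                    E⇒CycleAdj (subst₂ (E H) (sym (proj₂ (toWitness v∈))) (sym (proj₂ (toWitness w∈))) e) }
    }

  obstruction : Obstruction H
  obstruction = onCycle ,
    Iso-TwoConnected LongCycle-Iso LongCycle-TwoConnected ,
    Iso-TwoConnected (Iso-Complement LongCycle-Iso) Complement-LongCycle-TwoConnected

Induced-Delete : ∀ G (S : V G → Bool) (v : V G) → S v ≡ false →
                 Iso (Induced G S) (Induced (Delete G v) (S ∘ proj₁))
Induced-Delete G S v Sv≡false = record
  { to      = λ { (x , x∈S) → (x , NotV-intro G (λ { refl → subst T Sv≡false x∈S })) , x∈S }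
  ; from    = λ { ((x , _) , x∈S) → x , x∈S }
  ; to-from = λ _ → subtype-≡ (subtype-≡ refl)
  ; from-to = λ _ → refl
  ; to-E    = λ e → e
  ; from-E  = λ e → e
  }

Obstruction-spanning : ∀ {G} → Minimal G → ((S , _) : Obstruction G) → ∀ v → T (S v)
Obstruction-spanning {G} minimal (S , t , t̄) v with S v in Sv
... | true = tt
... | false = ⊥-elim (minimal (Delete G v) (inj₁ (v , here))
                (S ∘ proj₁ , Iso-TwoConnected I t , Iso-TwoConnected (Iso-Complement I) t̄))
  where I = Induced-Delete G S v Sv

InducedCycle-spanning : ∀ {G k} → Minimal G → (Z : InducedCycle G k) → ∀ v → InducedCycle.OnCycle Z v
InducedCycle-spanning minimal Z v = toWitness (Obstruction-spanning minimal (InducedCycle.obstruction Z) v)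

Induced-spanning : ∀ G (S : V G → Bool) → (∀ v → T (S v)) → Iso (Induced G S) G
Induced-spanning G S all∈S = record
  { to = proj₁ ; from = λ v → v , all∈S v ; to-from = λ _ → refl ; from-to = λ _ → subtype-≡ refl
  ; to-E = λ e → e ; from-E = λ e → e }

minimal-no-cut-vertex : ∀ {G} → ¬ TwoCograph G → Minimal G → ∀ w → ¬ ¬ Connected (Delete G w)
minimal-no-cut-vertex {G} non-cograph minimal w ¬conn =
  non-cograph λ obstruction@(S , (_ , _ , noCut) , _) →
    let all∈S = Obstruction-spanning minimal obstruction
    in noCut ((w , all∈S w) , ¬conn ∘ Iso-Connected (Iso-Delete (Induced-spanning G S all∈S) (w , all∈S w)))

-- Induced paths

InducedPath : ∀ G → V G → List (V G) → Set
InducedPath G x [] = ⊤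
InducedPath G x (y ∷ t) = E G x y × All (λ w → x ≢ w × ¬ E G x w) t × InducedPath G y t

pathEnd : ∀ {A : Set} → A → List A → A
pathEnd x [] = x
pathEnd _ (y ∷ t) = pathEnd y t

lookup-last : ∀ {A : Set} (x : A) t → lookup (x ∷ t) (fromℕ (length t)) ≡ pathEnd x t
lookup-last x [] = refl
lookup-last x (y ∷ t) = lookup-last y t

pathEnd-map : ∀ {A B : Set} (f : A → B) x t → pathEnd (f x) (map f t) ≡ f (pathEnd x t)
pathEnd-map f x [] = refl
pathEnd-map f x (y ∷ t) = pathEnd-map f y t

InducedPath-head∉ : ∀ {G x} t → InducedPath G x t → All (x ≢_) t
InducedPath-head∉ [] _ = []
InducedPath-head∉ {G} (y ∷ t) (xy , far , _) = E⇒≢ G xy ∷ All.map proj₁ far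

InducedPath-Induced : ∀ {G S x} t → InducedPath (Induced G S) x t → InducedPath G (proj₁ x) (map proj₁ t)
InducedPath-Induced [] _ = tt
InducedPath-Induced (y ∷ t) (xy , far , path) =
  xy , map⁺ (All.map (λ (x≢w , ¬xw) → x≢w ∘ subtype-≡ , ¬xw) far) , InducedPath-Induced t path

module _ {G : Graph} (adj? : DecAdj G) where

  private
    Touches : V G → V G → Set
    Touches x w = x ≡ w ⊎ E G x w

    avoids : ∀ {x t} → ¬ Any (Touches x) t → All (λ w → x ≢ w × ¬ E G x w) t
    avoids {t = []} _ = []
    avoids {t = w ∷ t} ¬touch =
      ((λ x≡w → ¬touch (here (inj₁ x≡w))) , (λ xw → ¬touch (here (inj₂ xw)))) ∷ avoids (¬touch ∘ there)

    -- x is joined to the last vertex of a ∷ t it touches, so the new path stays induced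
    prepend : ∀ {y} x a t → InducedPath G a t → pathEnd a t ≡ y → Any (Touches x) (a ∷ t) →
              Σ (List (V G)) λ t′ → InducedPath G x t′ × pathEnd x t′ ≡ y
    prepend x a [] _ end (here (inj₁ refl)) = [] , tt , end
    prepend x a [] _ end (here (inj₂ xa)) = a ∷ [] , (xa , [] , tt) , end
    prepend x a (b ∷ t) path end touch with any? (λ w → _≟V_ G x w ⊎-dec adj? x w) (b ∷ t)
    ... | yes touch′ = prepend x b t (proj₂ (proj₂ path)) end touch′
    ... | no ¬touch′ with touch
    ...   | there touch′ = ⊥-elim (¬touch′ touch′)
    ...   | here (inj₁ refl) = b ∷ t , path , end
    ...   | here (inj₂ xa) = a ∷ b ∷ t , (xa , avoids ¬touch′ , path) , end

  shortcut : ∀ {x y} → Reach G x y → Σ (List (V G)) λ t → InducedPath G x t × pathEnd x t ≡ y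
  shortcut stop = [] , tt , refl
  shortcut {x} (step {y = z} xz walk) with shortcut walk
  ... | t , path , end = prepend x z t path end (here (inj₂ xz))

data _⋖_ {n : ℕ} : Fin (suc n) → Fin (suc n) → Set where
  inject₁⋖suc : (k : Fin n) → inject₁ k ⋖ fsuc k

⋖-suc : ∀ {n} {i j : Fin (suc n)} → i ⋖ j → fsuc i ⋖ fsuc j
⋖-suc (inject₁⋖suc k) = inject₁⋖suc (fsuc k)

⋖⇒next : ∀ {n} {i j : Fin (suc n)} → i ⋖ j → next (fsuc i) ≡ fsuc j
⋖⇒next (inject₁⋖suc k) = next-inject₁ (fsuc k)

All-lookup : ∀ {A : Set} {P : A → Set} {xs} → All P xs → ∀ i → P (lookup xs i)
All-lookup ps i = All.lookup ps (∈-lookup i)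

module _ {G : Graph} where

  lookup-injective : ∀ {x} t → InducedPath G x t →
                     ∀ {i j} → lookup (x ∷ t) i ≡ lookup (x ∷ t) j → i ≡ j
  lookup-injective _ _ {fzero} {fzero} _ = refl
  lookup-injective (y ∷ t) path {fzero} {fsuc j} eq = ⊥-elim (All-lookup (InducedPath-head∉ (y ∷ t) path) j eq)
  lookup-injective (y ∷ t) path {fsuc i} {fzero} eq =
    ⊥-elim (All-lookup (InducedPath-head∉ (y ∷ t) path) i (sym eq))
  lookup-injective (y ∷ t) (_ , _ , path) {fsuc i} {fsuc j} eq = cong fsuc (lookup-injective t path eq)

  lookup-E⇒⋖ : ∀ {x} t → InducedPath G x t →
               ∀ {i j} → E G (lookup (x ∷ t) i) (lookup (x ∷ t) j) → i ⋖ j ⊎ j ⋖ i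
  lookup-E⇒⋖ _ _ {fzero} {fzero} e = ⊥-elim (E-irr G e)
  lookup-E⇒⋖ (y ∷ t) _ {fzero} {fsuc fzero} _ = inj₁ (inject₁⋖suc fzero)
  lookup-E⇒⋖ (y ∷ t) (_ , far , _) {fzero} {fsuc (fsuc j)} e = ⊥-elim (proj₂ (All-lookup far j) e)
  lookup-E⇒⋖ (y ∷ t) _ {fsuc fzero} {fzero} _ = inj₂ (inject₁⋖suc fzero)
  lookup-E⇒⋖ (y ∷ t) (_ , far , _) {fsuc (fsuc i)} {fzero} e =
    ⊥-elim (proj₂ (All-lookup far i) (E-sym G e))
  lookup-E⇒⋖ (y ∷ t) (_ , _ , path) {fsuc i} {fsuc j} e with lookup-E⇒⋖ t path e
  ... | inj₁ i⋖j = inj₁ (⋖-suc i⋖j)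
  ... | inj₂ j⋖i = inj₂ (⋖-suc j⋖i)

  ⋖⇒lookup-E : ∀ {x} t → InducedPath G x t →
               ∀ {i j} → i ⋖ j → E G (lookup (x ∷ t) i) (lookup (x ∷ t) j)
  ⋖⇒lookup-E (y ∷ t) (xy , _) (inject₁⋖suc fzero) = xy
  ⋖⇒lookup-E (y ∷ t) (_ , _ , path) (inject₁⋖suc (fsuc k)) = ⋖⇒lookup-E t path (inject₁⋖suc k)

module _ {G : Graph} {a h x₁ x₂ x₃ : V G} {r : List (V G)}
         (path  : InducedPath G h (x₁ ∷ x₂ ∷ x₃ ∷ r))
         (a-h   : E G a h)
         (a-end : E G a (pathEnd h (x₁ ∷ x₂ ∷ x₃ ∷ r)))
         (a∉    : All (a ≢_) (h ∷ x₁ ∷ x₂ ∷ x₃ ∷ r))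
         (a-nbr : All (λ w → E G a w → w ≡ h ⊎ w ≡ pathEnd h (x₁ ∷ x₂ ∷ x₃ ∷ r)) (h ∷ x₁ ∷ x₂ ∷ x₃ ∷ r))
  where

  private
    t : List (V G)
    t = x₁ ∷ x₂ ∷ x₃ ∷ r

    m : ℕ
    m = length t

    vertex : Fin (5 + length r) → V G
    vertex fzero = a
    vertex (fsuc i) = lookup (h ∷ t) i

    vertex-injective : ∀ {i j} → vertex i ≡ vertex j → i ≡ j
    vertex-injective {fzero} {fzero} _ = refl
    vertex-injective {fzero} {fsuc j} eq = ⊥-elim (All-lookup a∉ j eq)
    vertex-injective {fsuc i} {fzero} eq = ⊥-elim (All-lookup a∉ i (sym eq))
    vertex-injective {fsuc i} {fsuc j} eq = cong fsuc (lookup-injective t path eq)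

    a-E⇒CycleAdj : ∀ j → E G a (lookup (h ∷ t) j) → CycleAdj fzero (fsuc j)
    a-E⇒CycleAdj j e with All-lookup a-nbr j e
    ... | inj₁ at-h = inj₁ (cong fsuc (lookup-injective t path {fzero} {j} (sym at-h)))
    ... | inj₂ at-end = inj₂ (trans (cong (next ∘ fsuc) j≡last) (next-fromℕ (suc m)))
      where j≡last = lookup-injective t path {j} {fromℕ m} (trans at-end (sym (lookup-last h t)))

    E⇒CycleAdj : ∀ {i j} → E G (vertex i) (vertex j) → CycleAdj i j
    E⇒CycleAdj {fzero} {fzero} e = ⊥-elim (E-irr G e)
    E⇒CycleAdj {fzero} {fsuc j} e = a-E⇒CycleAdj j e
    E⇒CycleAdj {fsuc i} {fzero} e = ⊎-swap (a-E⇒CycleAdj i (E-sym G e))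
    E⇒CycleAdj {fsuc i} {fsuc j} e = ⊎-map ⋖⇒next ⋖⇒next (lookup-E⇒⋖ t path e)

    E-next : ∀ i → E G (vertex i) (vertex (next i))
    E-next fzero = a-h
    E-next (fsuc i) = by-position i (lastOrInject i)
      where
        by-position : ∀ i → LastOrInject i → E G (vertex (fsuc i)) (vertex (next (fsuc i)))
        by-position _ last =
          subst (E G (vertex (fsuc (fromℕ m))) ∘ vertex) (sym (next-fromℕ (suc m)))
            (subst (λ u → E G u a) (sym (lookup-last h t)) (E-sym G a-end))
        by-position _ (inject k) =
          subst (E G (vertex (fsuc (inject₁ k))) ∘ vertex) (sym (⋖⇒next (inject₁⋖suc k)))
            (⋖⇒lookup-E t path (inject₁⋖suc k))

    CycleAdj⇒E : ∀ {i j} → CycleAdj i j → E G (vertex i) (vertex j)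
    CycleAdj⇒E {i} (inj₁ refl) = E-next i
    CycleAdj⇒E {j = j} (inj₂ refl) = E-sym G (E-next j)

  close-InducedPath : InducedCycle G (length r)
  close-InducedPath = record
    { vertex = vertex ; vertex-injective = vertex-injective
    ; E⇒CycleAdj = E⇒CycleAdj ; CycleAdj⇒E = CycleAdj⇒E }

-- Edge contraction

module _ (G : Graph) {u v : V G} (u≢v : u ≢ v) where

  private
    G/uv = Contract G u v

    -- definitionally the representative map used in Contract
    rep : V G → V G
    rep x = if does (_≟V_ G x v) then u else x

    rep-≢v : ∀ x → rep x ≢ v
    rep-≢v x with _≟V_ G x v
    ... | yes _ = u≢v
    ... | no x≢v = x≢v

    rep-fixed : ∀ {x} → x ≢ v → rep x ≡ x
    rep-fixed {x} x≢v with _≟V_ G x v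
    ... | yes x≡v = ⊥-elim (x≢v x≡v)
    ... | no _ = refl

    rep-v : rep v ≡ u
    rep-v with _≟V_ G v v
    ... | yes _ = refl
    ... | no v≢v = ⊥-elim (v≢v refl)

  merge : V G → V G/uv
  merge x = rep x , NotV-intro G (rep-≢v x)

  merge-v : merge v ≡ merge u
  merge-v = subtype-≡ (trans rep-v (sym (rep-fixed u≢v)))

  merge-injective : ∀ {x y} → x ≢ v → y ≢ v → merge x ≡ merge y → x ≡ y
  merge-injective x≢v y≢v eq = trans (sym (rep-fixed x≢v)) (trans (cong proj₁ eq) (rep-fixed y≢v))

  merge-E : ∀ {x y} → merge x ≢ merge y → E G x y → E G/uv (merge x) (merge y)
  merge-E {x} {y} x≢y xy = x≢y ∘ subtype-≡ , x , y , xy , refl , refl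

  merge-E⁻¹ : ∀ {x y} → x ≢ u → x ≢ v → y ≢ u → y ≢ v → E G/uv (merge x) (merge y) → E G x y
  merge-E⁻¹ {x} {y} x≢u x≢v y≢u y≢v (_ , a , b , ab , a↦x , b↦y) =
    subst₂ (E G) (unmerge x≢u x≢v a↦x) (unmerge y≢u y≢v b↦y) ab
    where
      unmerge : ∀ {a x} → x ≢ u → x ≢ v → rep a ≡ rep x → a ≡ x
      unmerge {a} {x} x≢u x≢v a↦x with _≟V_ G a v
      ... | yes _ = ⊥-elim (x≢u (sym (trans a↦x (rep-fixed x≢v))))
      ... | no _ = trans a↦x (rep-fixed x≢v)

  merged-neighbour : ∀ {z} → E G/uv (merge u) z → Σ (V G) λ b → (E G u b ⊎ E G v b) × z ≡ merge b
  merged-neighbour (_ , a , b , ab , a↦u , b↦z) =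
    b , from-u-or-v , subtype-≡ (sym b↦z)
    where
      from-u-or-v : E G u b ⊎ E G v b
      from-u-or-v with _≟V_ G a v
      ... | yes refl = inj₂ ab
      ... | no _ = inj₁ (subst (λ a → E G a b) (trans a↦u (rep-fixed u≢v)) ab)

  InducedPath-merge : ∀ {x} t → All (λ w → w ≢ u × w ≢ v) (x ∷ t) → InducedPath G x t →
                      InducedPath G/uv (merge x) (map merge t)
  InducedPath-merge [] _ _ = tt
  InducedPath-merge {x} (y ∷ t) ((x≢u , x≢v) ∷ avoid) (xy , far , path) =
    merge-E (E⇒≢ G xy ∘ merge-injective x≢v y≢v) xy ,
    map⁺ (All.zipWith far-merged (All.tail avoid , far)) ,
    InducedPath-merge t avoid path
    where
      y≢v = proj₂ (All.head avoid)
      far-merged : ∀ {w} → (w ≢ u × w ≢ v) × (x ≢ w × ¬ E G x w) →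
                   merge x ≢ merge w × ¬ E G/uv (merge x) (merge w)
      far-merged ((w≢u , w≢v) , x≢w , ¬xw) =
        x≢w ∘ merge-injective x≢v w≢v , ¬xw ∘ merge-E⁻¹ x≢u x≢v w≢u w≢v

CycleAdj? : ∀ {n} (i j : Fin (suc n)) → Dec (CycleAdj i j)
CycleAdj? i j = (next i ≟ j) ⊎-dec (next j ≟ i)

CycleAdj⇔adj5 : ∀ i j → (CycleAdj i j → T (adj5 i j)) × (T (adj5 i j) → CycleAdj i j)
CycleAdj⇔adj5 = toWitness {a? = allFin? λ i → allFin? λ j →
  (CycleAdj? i j →-dec T? (adj5 i j)) ×-dec (T? (adj5 i j) →-dec CycleAdj? i j)} tt

spanning-InducedCycle-≅C5 : ∀ {G} (Z : InducedCycle G 0) → (∀ v → InducedCycle.OnCycle Z v) → G ≅ C5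
spanning-InducedCycle-≅C5 {G} Z spanning = mk↔ₛ′ position vertex position-vertex vertex-position , edges
  where
    open InducedCycle Z
    position : V G → Fin 5
    position = proj₁ ∘ spanning
    vertex-position : ∀ v → vertex (position v) ≡ v
    vertex-position = proj₂ ∘ spanning
    position-vertex : ∀ i → position (vertex i) ≡ i
    position-vertex i = vertex-injective (vertex-position (vertex i))
    edges : ∀ x y → E G x y ⇔ T (adj5 (position x) (position y))
    edges x y = mk⇔
      (proj₁ (CycleAdj⇔adj5 _ _) ∘ E⇒CycleAdj ∘
         subst₂ (E G) (sym (vertex-position x)) (sym (vertex-position y)))
      (subst₂ (E G) (vertex-position x) (vertex-position y) ∘ CycleAdj⇒E ∘ proj₂ (CycleAdj⇔adj5 _ _))

-- Suspended paths

Degree2-neighbours : ∀ {G x u v} → Degree2 G x → E G x u → E G x v → u ≢ v →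
                     ∀ c → E G x c → c ≡ u ⊎ c ≡ v
Degree2-neighbours (a , b , a≢b , _ , _ , nbr) xu xv u≢v c xc with nbr _ xu | nbr _ xv | nbr c xc
... | inj₁ refl | inj₁ refl | _ = ⊥-elim (u≢v refl)
... | inj₂ refl | inj₂ refl | _ = ⊥-elim (u≢v refl)
... | inj₁ refl | inj₂ refl | c≡a = c≡a
... | inj₂ refl | inj₁ refl | c≡b = ⊎-swap c≡b

record SuspendedPath₄ (G : Graph) : Set where
  field
    p₀ p₁ p₂ p₃ p₄ : V G
    p₀p₁ : E G p₀ p₁
    p₁p₂ : E G p₁ p₂
    p₂p₃ : E G p₂ p₃
    p₃p₄ : E G p₃ p₄
    p₀≢p₂ : p₀ ≢ p₂
    p₀≢p₃ : p₀ ≢ p₃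
    p₀≢p₄ : p₀ ≢ p₄
    p₁≢p₃ : p₁ ≢ p₃
    p₁≢p₄ : p₁ ≢ p₄
    p₂≢p₄ : p₂ ≢ p₄
    nbr₁ : ∀ c → E G p₁ c → c ≡ p₀ ⊎ c ≡ p₂
    nbr₂ : ∀ c → E G p₂ c → c ≡ p₁ ⊎ c ≡ p₃
    nbr₃ : ∀ c → E G p₃ c → c ≡ p₂ ⊎ c ≡ p₄

  p₀≢p₁ : p₀ ≢ p₁
  p₀≢p₁ = E⇒≢ G p₀p₁

  p₁≢p₂ : p₁ ≢ p₂
  p₁≢p₂ = E⇒≢ G p₁p₂

  p₂≢p₃ : p₂ ≢ p₃
  p₂≢p₃ = E⇒≢ G p₂p₃

  p₃≢p₄ : p₃ ≢ p₄
  p₃≢p₄ = E⇒≢ G p₃p₄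

  p₁-nonadjacent : ∀ {c} → c ≢ p₀ → c ≢ p₂ → ¬ E G p₁ c
  p₁-nonadjacent c≢p₀ c≢p₂ = [ c≢p₀ , c≢p₂ ]′ ∘ nbr₁ _

  p₂-nonadjacent : ∀ {c} → c ≢ p₁ → c ≢ p₃ → ¬ E G p₂ c
  p₂-nonadjacent c≢p₁ c≢p₃ = [ c≢p₁ , c≢p₃ ]′ ∘ nbr₂ _

  p₃-nonadjacent : ∀ {c} → c ≢ p₂ → c ≢ p₄ → ¬ E G p₃ c
  p₃-nonadjacent c≢p₂ c≢p₄ = [ c≢p₂ , c≢p₄ ]′ ∘ nbr₃ _

Path⇒SuspendedPath₄ : ∀ {G} (P : Path G) → 3 < len P → InternalDegree2 G P → SuspendedPath₄ G
Path⇒SuspendedPath₄ {G} record { len = suc (suc (suc (suc _))) ; vtx = p ; inj = inj ; adj = adj }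
                    (s≤s (s≤s (s≤s (s≤s z≤n)))) degree2 = record
  { p₀ = p 0F ; p₁ = p 1F ; p₂ = p 2F ; p₃ = p 3F ; p₄ = p 4F
  ; p₀p₁ = adj 0F ; p₁p₂ = adj 1F ; p₂p₃ = adj 2F ; p₃p₄ = adj 3F
  ; p₀≢p₂ = p-≢ λ () ; p₀≢p₃ = p-≢ λ () ; p₀≢p₄ = p-≢ λ ()
  ; p₁≢p₃ = p-≢ λ () ; p₁≢p₄ = p-≢ λ () ; p₂≢p₄ = p-≢ λ ()
  ; nbr₁ = Degree2-neighbours {G} (degree2 1F (s≤s z≤n)) (E-sym G (adj 0F)) (adj 1F) (p-≢ λ ())
  ; nbr₂ = Degree2-neighbours {G} (degree2 2F (s≤s z≤n)) (E-sym G (adj 1F)) (adj 2F) (p-≢ λ ())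
  ; nbr₃ = Degree2-neighbours {G} (degree2 3F (s≤s z≤n)) (E-sym G (adj 2F)) (adj 3F) (p-≢ λ ())
  }
  where
    p-≢ : ∀ {i j} → i ≢ j → p i ≢ p j
    p-≢ i≢j = i≢j ∘ inj _ _

module _ {G : Graph} (minimal : Minimal G) (P : SuspendedPath₄ G) where
  open SuspendedPath₄ P

  chord-cycle : E G p₀ p₄ → InducedCycle G 0
  chord-cycle p₀p₄ = close-InducedPath path p₀p₁ p₀p₄
    (p₀≢p₁ ∷ p₀≢p₂ ∷ p₀≢p₃ ∷ p₀≢p₄ ∷ [])
    ((λ _ → inj₁ refl) ∷ (⊥-elim ∘ p₂-nonadjacent p₀≢p₁ p₀≢p₃ ∘ E-sym G) ∷
     (⊥-elim ∘ p₃-nonadjacent p₀≢p₂ p₀≢p₄ ∘ E-sym G) ∷ (λ _ → inj₂ refl) ∷ [])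
    where
      path : InducedPath G p₁ (p₂ ∷ p₃ ∷ p₄ ∷ [])
      path = p₁p₂ , (p₁≢p₃ , p₁-nonadjacent (≢-sym p₀≢p₃) (≢-sym p₂≢p₃)) ∷
                    (p₁≢p₄ , p₁-nonadjacent (≢-sym p₀≢p₄) (≢-sym p₂≢p₄)) ∷ [] ,
             p₂p₃ , (p₂≢p₄ , p₂-nonadjacent (≢-sym p₁≢p₄) (≢-sym p₃≢p₄)) ∷ [] ,
             p₃p₄ , [] , tt

  chord⇒≅C5 : E G p₀ p₄ → G ≅ C5
  chord⇒≅C5 p₀p₄ = spanning-InducedCycle-≅C5 Z (InducedCycle-spanning minimal Z)
    where Z = chord-cycle p₀p₄

module _ {G : Graph} (adj? : DecAdj G) (minimal : Minimal G) (P : SuspendedPath₄ G) where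
  open SuspendedPath₄ P

  Interior : V G → Set
  Interior w = w ≡ p₁ ⊎ w ≡ p₂ ⊎ w ≡ p₃

  private
    interior? : ∀ w → Dec (Interior w)
    interior? w = _≟V_ G w p₁ ⊎-dec _≟V_ G w p₂ ⊎-dec _≟V_ G w p₃

    exterior : V G → Bool
    exterior w = isYes (¬? (interior? w))

    G⁻ : Graph
    G⁻ = Induced G exterior

    exterior-intro : ∀ {w} → w ≢ p₁ → w ≢ p₂ → w ≢ p₃ → T (exterior w)
    exterior-intro w≢p₁ w≢p₂ w≢p₃ = fromWitness [ w≢p₁ , [ w≢p₂ , w≢p₃ ]′ ]′

    exterior-elim : ∀ {w} → T (exterior w) → ¬ Interior w
    exterior-elim = toWitness

    p₁-neighbour : ∀ {w} → w ≢ p₂ → E G p₁ w → w ≡ p₀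
    p₁-neighbour w≢p₂ e = [ id , ⊥-elim ∘ w≢p₂ ]′ (nbr₁ _ e)

    p₃-neighbour : ∀ {w} → w ≢ p₂ → E G p₃ w → w ≡ p₄
    p₃-neighbour w≢p₂ e = [ ⊥-elim ∘ w≢p₂ , id ]′ (nbr₃ _ e)

    collapse : V G → V G
    collapse w with _≟V_ G w p₁ | _≟V_ G w p₃
    ... | yes _ | _ = p₀
    ... | no _ | yes _ = p₄
    ... | no _ | no _ = w

    data CollapseView (w : V G) : V G → Set where
      at-p₁ : w ≡ p₁ → CollapseView w p₀
      at-p₃ : w ≡ p₃ → CollapseView w p₄
      fixed : w ≢ p₁ → w ≢ p₃ → CollapseView w w

    collapse-view : ∀ w → CollapseView w (collapse w)
    collapse-view w with _≟V_ G w p₁ | _≟V_ G w p₃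
    ... | yes w≡p₁ | _ = at-p₁ w≡p₁
    ... | no _ | yes w≡p₃ = at-p₃ w≡p₃
    ... | no w≢p₁ | no w≢p₃ = fixed w≢p₁ w≢p₃

    collapse-fixed : ∀ {w} → w ≢ p₁ → w ≢ p₃ → collapse w ≡ w
    collapse-fixed {w} w≢p₁ w≢p₃ with collapse w | collapse-view w
    ... | _ | at-p₁ w≡p₁ = ⊥-elim (w≢p₁ w≡p₁)
    ... | _ | at-p₃ w≡p₃ = ⊥-elim (w≢p₃ w≡p₃)
    ... | _ | fixed _ _ = refl

    collapse-exterior : ∀ w → w ≢ p₂ → T (exterior (collapse w))
    collapse-exterior w w≢p₂ with collapse w | collapse-view w
    ... | _ | at-p₁ _ = exterior-intro p₀≢p₁ p₀≢p₂ p₀≢p₃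
    ... | _ | at-p₃ _ = exterior-intro (≢-sym p₁≢p₄) (≢-sym p₂≢p₄) (≢-sym p₃≢p₄)
    ... | _ | fixed w≢p₁ w≢p₃ = exterior-intro w≢p₁ w≢p₂ w≢p₃

    collapse-E : ∀ {v w} → v ≢ p₂ → w ≢ p₂ → E G v w →
                 collapse v ≡ collapse w ⊎ E G (collapse v) (collapse w)
    collapse-E {v} {w} v≢p₂ w≢p₂ vw with collapse v | collapse-view v | collapse w | collapse-view w
    ... | _ | at-p₁ refl | _ | at-p₁ refl = inj₁ refl
    ... | _ | at-p₃ refl | _ | at-p₃ refl = inj₁ refl
    ... | _ | at-p₁ refl | _ | at-p₃ refl = ⊥-elim (p₀≢p₃ (sym (p₁-neighbour (≢-sym p₂≢p₃) vw)))
    ... | _ | at-p₃ refl | _ | at-p₁ refl = ⊥-elim (p₀≢p₃ (sym (p₁-neighbour (≢-sym p₂≢p₃) (E-sym G vw))))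
    ... | _ | at-p₁ refl | _ | fixed _ _ = inj₁ (sym (p₁-neighbour w≢p₂ vw))
    ... | _ | at-p₃ refl | _ | fixed _ _ = inj₁ (sym (p₃-neighbour w≢p₂ vw))
    ... | _ | fixed _ _ | _ | at-p₁ refl = inj₁ (p₁-neighbour v≢p₂ (E-sym G vw))
    ... | _ | fixed _ _ | _ | at-p₃ refl = inj₁ (p₃-neighbour v≢p₂ (E-sym G vw))
    ... | _ | fixed _ _ | _ | fixed _ _ = inj₂ vw

    to-G⁻ : V (Delete G p₂) → V G⁻
    to-G⁻ (w , w≢p₂) = collapse w , collapse-exterior w (NotV-elim G w≢p₂)

    to-G⁻-collapsing : EdgeCollapsing (Delete G p₂) G⁻ to-G⁻
    to-G⁻-collapsing {v , v≢p₂} {w , w≢p₂} vw =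
      ⊎-map subtype-≡ (λ e → e) (collapse-E (NotV-elim G v≢p₂) (NotV-elim G w≢p₂) vw)

  exterior-path : Connected (Delete G p₂) →
                  Σ (List (V G)) λ t → InducedPath G p₀ t × pathEnd p₀ t ≡ p₄ × All (¬_ ∘ Interior) t
  exterior-path conn with shortcut (λ x y → adj? (proj₁ x) (proj₁ y)) walk
    where
      walk : Reach G⁻ (p₀ , exterior-intro p₀≢p₁ p₀≢p₂ p₀≢p₃)
                      (p₄ , exterior-intro (≢-sym p₁≢p₄) (≢-sym p₂≢p₄) (≢-sym p₃≢p₄))
      walk = subst₂ (Reach G⁻) (subtype-≡ (collapse-fixed p₀≢p₁ p₀≢p₃))
                               (subtype-≡ (collapse-fixed (≢-sym p₁≢p₄) (≢-sym p₃≢p₄)))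
               (Reach-map {Delete G p₂} to-G⁻ (λ {x} {y} → to-G⁻-collapsing {x} {y})
                  (conn (p₀ , NotV-intro G p₀≢p₂) (p₄ , NotV-intro G (≢-sym p₂≢p₄))))
  ... | t , path , end =
    map proj₁ t , InducedPath-Induced t path , trans (pathEnd-map proj₁ _ t) (cong proj₁ end) ,
    map⁺ (All.universal (exterior-elim ∘ proj₂) t)

  private
    G′ : Graph
    G′ = Contract G p₂ p₃

    μ : V G → V G′
    μ = merge G p₂≢p₃

    μ-injective : ∀ {x y} → x ≢ p₃ → y ≢ p₃ → μ x ≡ μ y → x ≡ y
    μ-injective = merge-injective G p₂≢p₃

    merged-p₂-neighbours : ∀ z → E G′ (μ p₂) z → z ≡ μ p₁ ⊎ z ≡ μ p₄
    merged-p₂-neighbours z e with merged-neighbour G p₂≢p₃ e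
    ... | b , p₂b⊎p₃b , z≡μb = by-cases (⊎-map (nbr₂ b) (nbr₃ b) p₂b⊎p₃b)
      where
        via : ∀ {c} → b ≡ c → z ≡ μ c
        via b≡c = trans z≡μb (cong μ b≡c)
        z≢μp₂ : z ≢ μ p₂
        z≢μp₂ z≡μp₂ = E-irr G′ {μ p₂} (subst (E G′ (μ p₂)) z≡μp₂ e)
        by-cases : (b ≡ p₁ ⊎ b ≡ p₃) ⊎ (b ≡ p₂ ⊎ b ≡ p₄) → z ≡ μ p₁ ⊎ z ≡ μ p₄
        by-cases (inj₁ (inj₁ b≡p₁)) = inj₁ (via b≡p₁)
        by-cases (inj₁ (inj₂ b≡p₃)) = ⊥-elim (z≢μp₂ (trans (via b≡p₃) (merge-v G p₂≢p₃)))
        by-cases (inj₂ (inj₁ b≡p₂)) = ⊥-elim (z≢μp₂ (via b≡p₂))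
        by-cases (inj₂ (inj₂ b≡p₄)) = inj₂ (via b≡p₄)

    μp₂-μp₄ : E G′ (μ p₂) (μ p₄)
    μp₂-μp₄ = subst (λ x → E G′ x (μ p₄)) (merge-v G p₂≢p₃) (merge-E G p₂≢p₃ μp₃≢μp₄ p₃p₄)
      where μp₃≢μp₄ : μ p₃ ≢ μ p₄
            μp₃≢μp₄ eq = p₂≢p₄ (μ-injective p₂≢p₃ (≢-sym p₃≢p₄) (trans (sym (merge-v G p₂≢p₃)) eq))

  contracted-cycle : ∀ {t} → InducedPath G p₀ t → pathEnd p₀ t ≡ p₄ → All (¬_ ∘ Interior) t →
                     ¬ E G p₀ p₄ → Σ ℕ (InducedCycle G′)
  contracted-cycle {[]} _ end _ _ = ⊥-elim (p₀≢p₄ end)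
  contracted-cycle {w ∷ []} (p₀w , _) end _ ¬chord = ⊥-elim (¬chord (subst (E G p₀) end p₀w))
  contracted-cycle {t@(_ ∷ _ ∷ r)} path end exterior ¬chord =
    length (map μ r) , close-InducedPath path′ μp₂-μp₁ μp₂-end μp₂∉ μp₂-nbr
    where
      off-p₂p₃ : All (λ x → x ≢ p₂ × x ≢ p₃) (p₁ ∷ p₀ ∷ t)
      off-p₂p₃ = (p₁≢p₂ , p₁≢p₃) ∷ (p₀≢p₂ , p₀≢p₃) ∷
                 All.map (λ ¬int → ¬int ∘ inj₂ ∘ inj₁ , ¬int ∘ inj₂ ∘ inj₂) exterior

      extended : InducedPath G p₁ (p₀ ∷ t)
      extended = E-sym G p₀p₁ ,
        All.zipWith (λ (¬int , p₀≢x) → ¬int ∘ inj₁ ∘ sym , p₁-nonadjacent (≢-sym p₀≢x) (¬int ∘ inj₂ ∘ inj₁))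
          (exterior , InducedPath-head∉ t path) ,
        path

      path′ : InducedPath G′ (μ p₁) (map μ (p₀ ∷ t))
      path′ = InducedPath-merge G p₂≢p₃ (p₀ ∷ t) off-p₂p₃ extended

      μp₂-μp₁ : E G′ (μ p₂) (μ p₁)
      μp₂-μp₁ = merge-E G p₂≢p₃ (≢-sym p₁≢p₂ ∘ μ-injective p₂≢p₃ p₁≢p₃) (E-sym G p₁p₂)

      μp₄-end : μ p₄ ≡ pathEnd (μ p₁) (map μ (p₀ ∷ t))
      μp₄-end = sym (trans (pathEnd-map μ p₁ (p₀ ∷ t)) (cong μ end))

      μp₂-end : E G′ (μ p₂) (pathEnd (μ p₁) (map μ (p₀ ∷ t)))
      μp₂-end = subst (E G′ (μ p₂)) μp₄-end μp₂-μp₄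

      μp₂∉ : All (μ p₂ ≢_) (map μ (p₁ ∷ p₀ ∷ t))
      μp₂∉ = map⁺ (All.map (λ (x≢p₂ , x≢p₃) → ≢-sym x≢p₂ ∘ μ-injective p₂≢p₃ x≢p₃) off-p₂p₃)

      μp₂-nbr : All (λ z → E G′ (μ p₂) z → z ≡ μ p₁ ⊎ z ≡ pathEnd (μ p₁) (map μ (p₀ ∷ t)))
                    (map μ (p₁ ∷ p₀ ∷ t))
      μp₂-nbr = All.universal (λ z → ⊎-map₂ (λ z≡μp₄ → trans z≡μp₄ μp₄-end) ∘ merged-p₂-neighbours z) _

  chordless⇒cut-vertex : ¬ E G p₀ p₄ → ¬ Connected (Delete G p₂)
  chordless⇒cut-vertex ¬chord conn with exterior-path conn
  ... | t , path , end , exterior with contracted-cycle path end exterior ¬chord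
  ... | _ , Z = minimal G′ (inj₂ (p₂ , p₃ , p₂p₃ , here)) (InducedCycle.obstruction Z)

lemma3p10 : (G : Graph) → Finite G → DecAdj G →
    MinimalNon2Cograph G → MinimalNon2Cograph (Complement G) →
    (P : Path G) → 3 < len P → InternalDegree2 G P →
    G ≅ C5
lemma3p10 G _ adj? (non-cograph , minimal) _ P 3<len degree2 = by-chord (adj? p₀ p₄)
  where
    S : SuspendedPath₄ G
    S = Path⇒SuspendedPath₄ P 3<len degree2
    open SuspendedPath₄ S
    by-chord : Dec (E G p₀ p₄) → G ≅ C5
    by-chord (yes chord) = chord⇒≅C5 minimal S chord
    by-chord (no ¬chord) =
      ⊥-elim (minimal-no-cut-vertex non-cograph minimal p₂ (chordless⇒cut-vertex adj? minimal S ¬chord))
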